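{- Let $7 \le p \le q$ and let $D$ be a strong orientation of $K(3,p,q)$ with diameter two, with parts $V_1=\{x_1,x_2,x_3\}$, $V_2$ ($|V_2|=p$), $V_3$ ($|V_3|=q$). Then it is not the case that exactly seven of the eight sets $V_2^A$ ($A \subseteq \{1,2,3\}$) are nonempty.
   Context: $K(3,p,q)$ is the complete tripartite graph with parts $V_1=\{x_1,x_2,x_3\}$, $V_2$ of size $p$, $V_3$ of size $q$. A strong orientation is an orientation of all edges making the digraph strongly connected; its diameter is the maximum directed distance between ordered pairs of vertices. Write $u\to v$ if the edge $uv$ is oriented from $u$ to $v$. For $A \subseteq [3]=\{1,2,3\}$, let $N_D^A$ be the set of vertices $w$ such that $x_i \to w$ for all $i \in A$ and $w \to x_j$ for all $j \in [3]\setminus A$, and $V_2^A = V_2 \cap N_D^A$. The eight sets $V_2^A$ partition $V_2$. -}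

module Defs where

open import Data.Nat using (ℕ; zero; suc)
open import Data.Bool using (Bool; true; false; not; _≟_)
open import Data.Fin using (Fin)
open import Data.Fin.Properties using (any?; all?)
open import Data.Fin.Subset using (Subset)
open import Data.Vec using (Vec; []; _∷_; lookup)
open import Data.List using (List; []; _∷_; _++_; map; filter; length)
open import Data.Sum using (_⊎_; inj₁; inj₂)
open import Data.Product using (_×_; Σ; ∃; ∃-syntax; _,_)
open import Relation.Binary.PropositionalEquality using (_≡_)
open import Relation.Nullary using (¬_; Dec)

-- Each edge between different parts gets exactly one direction, recorded by a Bool:
--   d12 i w ≡ true  ⇔  x_i → w   (otherwise w → x_i), for w ∈ V2
--   d13 i w ≡ true  ⇔  x_i → w   (otherwise w → x_i), for w ∈ V3
--   d23 v w ≡ true  ⇔  v → w     (otherwise w → v),   for v ∈ V2, w ∈ V3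
record Orientation (p q : ℕ) : Set where
  field
    d12 : Fin 3 → Fin p → Bool
    d13 : Fin 3 → Fin q → Bool
    d23 : Fin p → Fin q → Bool
open Orientation public

Vertex : ℕ → ℕ → Set
Vertex p q = Fin 3 ⊎ (Fin p ⊎ Fin q)

arcB : ∀ {p q} → Orientation p q → Vertex p q → Vertex p q → Bool
arcB D (inj₁ i)        (inj₁ j)        = false
arcB D (inj₁ i)        (inj₂ (inj₁ w)) = d12 D i w
arcB D (inj₁ i)        (inj₂ (inj₂ w)) = d13 D i w
arcB D (inj₂ (inj₁ v)) (inj₁ i)        = not (d12 D i v)
arcB D (inj₂ (inj₁ v)) (inj₂ (inj₁ w)) = false
arcB D (inj₂ (inj₁ v)) (inj₂ (inj₂ w)) = d23 D v w
arcB D (inj₂ (inj₂ v)) (inj₁ i)        = not (d13 D i v)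
arcB D (inj₂ (inj₂ v)) (inj₂ (inj₁ w)) = not (d23 D w v)
arcB D (inj₂ (inj₂ v)) (inj₂ (inj₂ w)) = false

Arc : ∀ {p q} → Orientation p q → Vertex p q → Vertex p q → Set
Arc D u v = arcB D u v ≡ true

Dist≤1 : ∀ {p q} → Orientation p q → Vertex p q → Vertex p q → Set
Dist≤1 D u v = (u ≡ v) ⊎ Arc D u v

Dist≤2 : ∀ {p q} → Orientation p q → Vertex p q → Vertex p q → Set
Dist≤2 D u v = Dist≤1 D u v ⊎ (∃[ w ] (Arc D u w × Arc D w v))

-- D is strongly connected with diameter exactly two: every ordered pair is at
-- distance ≤ 2 (which in particular makes D strong), and some pair is at distance 2.
Diameter2 : ∀ {p q} → Orientation p q → Set
Diameter2 D = (∀ u v → Dist≤2 D u v) × (∃[ u ] ∃[ v ] ¬ Dist≤1 D u v)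

-- A ⊆ [3] is a Subset 3 (lookup A i ≡ true ⇔ i ∈ A).
-- w ∈ V2^A  ⇔  for all i: (x_i → w if i ∈ A) and (w → x_i if i ∉ A).
InV2 : ∀ {p q} → Orientation p q → Subset 3 → Fin p → Set
InV2 D A w = ∀ i → d12 D i w ≡ lookup A i

inV2? : ∀ {p q} (D : Orientation p q) (A : Subset 3) (w : Fin p) → Dec (InV2 D A w)
inV2? D A w = all? (λ i → d12 D i w ≟ lookup A i)

NonemptyV2 : ∀ {p q} → Orientation p q → Subset 3 → Set
NonemptyV2 D A = ∃[ w ] InV2 D A w

nonemptyV2? : ∀ {p q} (D : Orientation p q) (A : Subset 3) → Dec (NonemptyV2 D A)
nonemptyV2? D A = any? (inV2? D A)

-- list of all subsets of [n] (each exactly once)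
allSubsets : (n : ℕ) → List (Subset n)
allSubsets zero    = [] ∷ []
allSubsets (suc n) = map (true ∷_) (allSubsets n) ++ map (false ∷_) (allSubsets n)

numNonemptyV2 : ∀ {p q} → Orientation p q → ℕ
numNonemptyV2 D = length (filter (nonemptyV2? D) (allSubsets 3))

{-# OPTIONS --safe #-}

-- Every 2-path between V2 and V3 passes through V1, so a vertex of V2 and a vertex of V3 with the
-- same adjacency pattern towards V1 cannot reach each other both ways within two steps. Hence
-- V2^A is empty whenever A is the type of a vertex of V3, and if only one V2^A is empty, all of
-- V3 has a single type T. Two vertices of V3 of type ∅ (or [3]) are then too far apart, while for
-- ∅ ≠ T ≠ [3] a vertex of V2^∅ is too far from x_j, j ∉ T. So |V3| ≤ 1, although q ≥ 7.

module Submission where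

open import Defs
open import Data.Nat using (ℕ; _≤_; _+_; suc; s≤s)
open import Data.Nat.Properties using (≤-trans; m≤n⇒m≤1+n; 1+n≰n)
open import Data.Bool using (true; false)
import Data.Bool as Bool
open import Data.Bool.Properties using (¬-not; not-injective)
open import Data.Fin using (Fin; zero; suc)
open import Data.Fin.Properties using (all?; ¬∀⟶∃¬; 0≢1+n)
import Data.Fin as Fin
open import Data.Fin.Subset using (Subset) renaming (⊥ to ∅)
open import Data.Vec using ([]; _∷_; lookup; tabulate)
open import Data.Vec.Properties using (≡-dec; lookup∘tabulate; lookup-replicate)
open import Data.List using (_∷_; map; filter; length)
open import Data.List.Properties using (filter-reject; filter-notAll)
open import Data.List.Membership.Propositional using (_∈_)
open import Data.List.Membership.Propositional.Properties using (∈-map⁺; ∈-++⁺ˡ; ∈-++⁺ʳ)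
open import Data.List.Relation.Unary.Any using (here; there)
import Data.List.Relation.Unary.Any as Any
open import Data.Sum using (_⊎_; inj₁; inj₂; [_,_]′)
open import Data.Product using (_×_; ∃-syntax; _,_)
open import Data.Empty using (⊥; ⊥-elim)
open import Relation.Binary.PropositionalEquality using (_≡_; _≢_; refl; sym; trans; cong; subst)
open import Relation.Nullary using (¬_; yes; no; does; contradiction)
open import Relation.Nullary.Decidable using (decidable-stable)
open import Relation.Unary using (Pred; Decidable)

module _ {a p} {A : Set a} {P : Pred A p} (P? : Decidable P) where

  length-filter-rejecting-two : ∀ xs {x y} → x ∈ xs → y ∈ xs → x ≢ y → ¬ P x → ¬ P y →
                                2 + length (filter P? xs) ≤ length xs
  length-filter-rejecting-two (z ∷ zs) (here refl) (here refl) x≢y _ _ = contradiction refl x≢y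
  length-filter-rejecting-two (z ∷ zs) (here refl) (there y∈zs) _ ¬Pz ¬Py
    rewrite filter-reject P? {z} {zs} ¬Pz =
      s≤s (filter-notAll P? zs (Any.map (λ { refl → ¬Py }) y∈zs))
  length-filter-rejecting-two (z ∷ zs) (there x∈zs) (here refl) _ ¬Px ¬Pz
    rewrite filter-reject P? {z} {zs} ¬Pz =
      s≤s (filter-notAll P? zs (Any.map (λ { refl → ¬Px }) x∈zs))
  length-filter-rejecting-two (z ∷ zs) (there x∈zs) (there y∈zs) x≢y ¬Px ¬Py
    with ih ← length-filter-rejecting-two zs x∈zs y∈zs x≢y ¬Px ¬Py | does (P? z)
  ... | false = m≤n⇒m≤1+n ih
  ... | true  = s≤s ih

∈-allSubsets : ∀ n (A : Subset n) → A ∈ allSubsets n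
∈-allSubsets 0       []          = here refl
∈-allSubsets (suc n) (true ∷ A)  = ∈-++⁺ˡ (∈-map⁺ (true ∷_) (∈-allSubsets n A))
∈-allSubsets (suc n) (false ∷ A) =
  ∈-++⁺ʳ (map (true ∷_) (allSubsets n)) (∈-map⁺ (false ∷_) (∈-allSubsets n A))

module _ {p q} (D : Orientation p q) (seven : numNonemptyV2 D ≡ 7) where

  emptyV2-unique : ∀ {A B} → ¬ NonemptyV2 D A → ¬ NonemptyV2 D B → A ≡ B
  emptyV2-unique {A} {B} ¬A ¬B = decidable-stable (≡-dec Bool._≟_ A B) λ A≢B →
    1+n≰n (subst (λ n → 2 + n ≤ 8) seven
      (length-filter-rejecting-two (nonemptyV2? D) (allSubsets 3)
        (∈-allSubsets 3 A) (∈-allSubsets 3 B) A≢B ¬A ¬B))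

  nonemptyV2-except : ∀ {A} → ¬ NonemptyV2 D A → ∀ B → B ≢ A → NonemptyV2 D B
  nonemptyV2-except ¬A B B≢A =
    decidable-stable (nonemptyV2? D B) λ ¬B → B≢A (emptyV2-unique ¬B ¬A)

type₃ : ∀ {p q} → Orientation p q → Fin q → Subset 3
type₃ D v = tabulate (λ i → d13 D i v)

lookup-type₃ : ∀ {p q} (D : Orientation p q) v i → lookup (type₃ D v) i ≡ d13 D i v
lookup-type₃ D v = lookup∘tabulate (λ i → d13 D i v)

true≢false : true ≢ false
true≢false ()

∅≢type₃ : ∀ {p q} (D : Orientation p q) {i v} → d13 D i v ≡ true → ∅ ≢ type₃ D v
∅≢type₃ D {i} {v} i→v ∅≡type₃ = true≢false (begin
  true                 ≡⟨ i→v ⟨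
  d13 D i v            ≡⟨ lookup-type₃ D v i ⟨
  lookup (type₃ D v) i ≡⟨ cong (λ A → lookup A i) ∅≡type₃ ⟨
  lookup ∅ i           ≡⟨ lookup-replicate i false ⟩
  false                ∎)
  where open Relation.Binary.PropositionalEquality.≡-Reasoning

module _ {p q} {D : Orientation p q} (diam : ∀ u v → Dist≤2 D u v) where

  arc₂₃⇒path₃₁₂ : ∀ {u v} → d23 D u v ≡ true → ∃[ i ] (d13 D i v ≡ false × d12 D i u ≡ true)
  arc₂₃⇒path₃₁₂ {u} {v} u→v with diam (inj₂ (inj₂ v)) (inj₂ (inj₁ u))
  ... | inj₁ (inj₂ v→u) = contradiction (trans (sym u→v) (not-injective v→u)) true≢false
  ... | inj₂ (inj₁ i , v→i , i→u) = i , not-injective v→i , i→u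
  ... | inj₂ (inj₂ (inj₁ _) , _ , ())
  ... | inj₂ (inj₂ (inj₂ _) , () , _)

  arc₃₂⇒path₂₁₃ : ∀ {u v} → d23 D u v ≡ false → ∃[ i ] (d12 D i u ≡ false × d13 D i v ≡ true)
  arc₃₂⇒path₂₁₃ {u} {v} v→u with diam (inj₂ (inj₁ u)) (inj₂ (inj₂ v))
  ... | inj₁ (inj₂ u→v) = contradiction (trans (sym u→v) v→u) true≢false
  ... | inj₂ (inj₁ i , u→i , i→v) = i , not-injective u→i , i→v
  ... | inj₂ (inj₂ (inj₁ _) , () , _)
  ... | inj₂ (inj₂ (inj₂ _) , _ , ())

  no-V1-twins : ∀ u v → ¬ (∀ i → d12 D i u ≡ d13 D i v)
  no-V1-twins u v twin with d23 D u v in eq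
  ... | true  with i , v→i , i→u ← arc₂₃⇒path₃₁₂ eq =
    true≢false (trans (sym i→u) (trans (twin i) v→i))
  ... | false with i , u→i , i→v ← arc₃₂⇒path₂₁₃ eq =
    true≢false (trans (sym i→v) (trans (sym (twin i)) u→i))

  type₃-emptyV2 : ∀ v → ¬ NonemptyV2 D (type₃ D v)
  type₃-emptyV2 v (u , u∈) = no-V1-twins u v λ i → trans (u∈ i) (lookup-type₃ D v i)

  V3-out-to-V1-unique : ∀ {v₀ v₁} → v₀ ≢ v₁ →
    (∀ i → d13 D i v₀ ≡ false) → (∀ i → d13 D i v₁ ≡ false) → ⊥
  V3-out-to-V1-unique {v₀} {v₁} v₀≢v₁ out₀ out₁ with diam (inj₂ (inj₂ v₀)) (inj₂ (inj₂ v₁))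
  ... | inj₁ (inj₁ refl) = v₀≢v₁ refl
  ... | inj₂ (inj₁ i , _ , i→v₁) = true≢false (trans (sym i→v₁) (out₁ i))
  ... | inj₂ (inj₂ (inj₁ u) , v₀→u , _) with i , _ , i→v₀ ← arc₃₂⇒path₂₁₃ (not-injective v₀→u) =
    true≢false (trans (sym i→v₀) (out₀ i))
  ... | inj₂ (inj₂ (inj₂ _) , () , _)

  V3-in-from-V1-unique : ∀ {v₀ v₁} → v₀ ≢ v₁ →
    (∀ i → d13 D i v₀ ≡ true) → (∀ i → d13 D i v₁ ≡ true) → ⊥
  V3-in-from-V1-unique {v₀} {v₁} v₀≢v₁ in₀ in₁ with diam (inj₂ (inj₂ v₁)) (inj₂ (inj₂ v₀))
  ... | inj₁ (inj₁ refl) = v₀≢v₁ refl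
  ... | inj₂ (inj₁ i , v₁→i , _) = true≢false (trans (sym (in₁ i)) (not-injective v₁→i))
  ... | inj₂ (inj₂ (inj₁ u) , _ , u→v₀) with i , v₀→i , _ ← arc₂₃⇒path₃₁₂ u→v₀ =
    true≢false (trans (sym (in₀ i)) v₀→i)
  ... | inj₂ (inj₂ (inj₂ _) , () , _)

  V2-out-to-V1⇒V3-in : ∀ {u j} → (∀ i → d12 D i u ≡ false) → ∃[ w ] d13 D j w ≡ true
  V2-out-to-V1⇒V3-in {u} {j} out with diam (inj₁ j) (inj₂ (inj₁ u))
  ... | inj₁ (inj₂ j→u) = contradiction (trans (sym j→u) (out j)) true≢false
  ... | inj₂ (inj₁ _ , () , _)
  ... | inj₂ (inj₂ (inj₁ _) , _ , ())
  ... | inj₂ (inj₂ (inj₂ w) , j→w , _) = w , j→w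

module _ {p q} {D : Orientation p q} (diam : ∀ u v → Dist≤2 D u v) (seven : numNonemptyV2 D ≡ 7) where

  type₃-unique : ∀ v w → type₃ D v ≡ type₃ D w
  type₃-unique v w = emptyV2-unique D seven (type₃-emptyV2 diam v) (type₃-emptyV2 diam w)

  type₃-constant : ∀ i v w → d13 D i v ≡ d13 D i w
  type₃-constant i v w = begin
    d13 D i v              ≡⟨ lookup-type₃ D v i ⟨
    lookup (type₃ D v) i   ≡⟨ cong (λ A → lookup A i) (type₃-unique v w) ⟩
    lookup (type₃ D w) i   ≡⟨ lookup-type₃ D w i ⟩
    d13 D i w              ∎
    where open Relation.Binary.PropositionalEquality.≡-Reasoning

  type₃-not-mixed : ∀ {i j v} → d13 D i v ≡ true → d13 D j v ≡ false → ⊥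
  type₃-not-mixed {i} {j} {v} i→v v→j
    with u , u∈∅ ← nonemptyV2-except D seven (type₃-emptyV2 diam v) ∅ (∅≢type₃ D i→v)
    with w , j→w ← V2-out-to-V1⇒V3-in diam {j = j} (λ k → trans (u∈∅ k) (lookup-replicate k false))
    = true≢false (trans (sym j→w) (trans (type₃-constant j w v) v→j))

  type₃-∅-or-full : ∀ v → (∀ i → d13 D i v ≡ false) ⊎ (∀ i → d13 D i v ≡ true)
  type₃-∅-or-full v with all? (λ i → d13 D i v Bool.≟ true)
  ... | yes full = inj₂ full
  ... | no ¬full with j , j↛v ← ¬∀⟶∃¬ 3 _ (λ i → d13 D i v Bool.≟ true) ¬full
    with all? (λ i → d13 D i v Bool.≟ false)
  ... | yes empty = inj₁ empty
  ... | no ¬empty with i , i↛v ← ¬∀⟶∃¬ 3 _ (λ i → d13 D i v Bool.≟ false) ¬empty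
    = ⊥-elim (type₃-not-mixed (¬-not i↛v) (¬-not j↛v))

  V3-subsingleton : ∀ v₀ v₁ → v₀ ≡ v₁
  V3-subsingleton v₀ v₁ = decidable-stable (v₀ Fin.≟ v₁) λ v₀≢v₁ →
    [ (λ out₀ → V3-out-to-V1-unique diam v₀≢v₁ out₀ (same-as-v₀ out₀))
    , (λ in₀ → V3-in-from-V1-unique diam v₀≢v₁ in₀ (same-as-v₀ in₀))
    ]′ (type₃-∅-or-full v₀)
    where
    same-as-v₀ : ∀ {b} → (∀ i → d13 D i v₀ ≡ b) → ∀ i → d13 D i v₁ ≡ b
    same-as-v₀ all-b i = trans (type₃-constant i v₁ v₀) (all-b i)

theorem4p23 : (p q : ℕ) → 7 ≤ p → p ≤ q → (D : Orientation p q) → Diameter2 D →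
    ¬ (numNonemptyV2 D ≡ 7)
theorem4p23 p q 7≤p p≤q D (diam , _) seven with ≤-trans 7≤p p≤q
... | s≤s (s≤s _) = 0≢1+n (V3-subsingleton diam seven zero (suc zero))
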